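{- Let $n \geq 1$ and let $\varphi$ be a Boolean formula in Precise Conjunctive Normal Form whose variables are among a set of $n$ variables. If $\varphi$ has more than $f(n) = \sum_{i=1}^{n} 2^{i}\binom{n}{i} - \sum_{i=1}^{n}\binom{n}{i}$ $(=3^n-2^n)$ clauses, then $\varphi$ has no satisfying truth assignment.
   Context: A literal is a variable $x$ or its complement $\sim x$. A clause is a (nonempty) disjunction of literals; a formula in conjunctive normal form is a conjunction of clauses. A Boolean formula is in Precise Conjunctive Normal Form (PCNF) if it is a conjunction of pairwise distinct clauses, where each clause is a disjunction of pairwise distinct literals and no clause contains both a variable and its complement. Clauses are identified as sets of literals. A truth assignment satisfies the formula if it makes every clause true. -}

module Defs where

open import Data.Nat using (ℕ; zero; suc; _+_; _*_; _∸_; _^_)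
open import Data.Nat.Combinatorics using (_C_)
open import Data.Fin using (Fin)
open import Data.Bool using (Bool; true; false; not; _≟_)
open import Data.Product using (_×_; _,_; proj₁; proj₂)
open import Data.List using (List; []; _∷_; length)
open import Data.List.Relation.Unary.All using (All)
open import Data.List.Relation.Unary.Any using (Any)
open import Data.List.Relation.Unary.AllPairs using (AllPairs)
open import Data.List.Relation.Unary.Unique.Propositional using (Unique)
open import Data.List.Membership.Propositional using (_∈_)
open import Relation.Binary.PropositionalEquality using (_≡_)
open import Relation.Nullary using (¬_)

-- A literal over variables Fin n: (x , true) is x, (x , false) is ~x.
Literal : ℕ → Set
Literal n = Fin n × Bool

complement : ∀ {n} → Literal n → Literal n
complement (x , b) = (x , not b)

-- A clause is represented by a list of literals (identified with its set).
Clause : ℕ → Set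
Clause n = List (Literal n)

NonEmpty : ∀ {A : Set} → List A → Set
NonEmpty [] = Data.Empty.⊥ where import Data.Empty
NonEmpty (_ ∷ _) = Data.Unit.⊤ where import Data.Unit

SameSet : ∀ {n} → Clause n → Clause n → Set
SameSet c d = (∀ l → l ∈ c → l ∈ d) × (∀ l → l ∈ d → l ∈ c)

PreciseClause : ∀ {n} → Clause n → Set
PreciseClause c = NonEmpty c × Unique c × (∀ l → l ∈ c → ¬ (complement l ∈ c))

Formula : ℕ → Set
Formula n = List (Clause n)

IsPCNF : ∀ {n} → Formula n → Set
IsPCNF φ = All PreciseClause φ × AllPairs (λ c d → ¬ SameSet c d) φ

Assignment : ℕ → Set
Assignment n = Fin n → Bool

litTrue : ∀ {n} → Assignment n → Literal n → Set
litTrue v (x , b) = v x ≡ b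

Satisfies : ∀ {n} → Assignment n → Formula n → Set
Satisfies v φ = All (λ c → Any (litTrue v) c) φ

sumFrom1 : ℕ → (ℕ → ℕ) → ℕ
sumFrom1 zero g = 0
sumFrom1 (suc k) g = sumFrom1 k g + g (suc k)

f : ℕ → ℕ
f n = sumFrom1 n (λ i → 2 ^ i * (n C i)) ∸ sumFrom1 n (λ i → n C i)

-- Fix a satisfying assignment v. Record a clause c, relative to v, as the word in
-- {absent, agreeing, opposing}^n saying for each variable x whether c omits x,
-- contains the literal of x that v makes true, or contains its complement. A precise
-- clause contains at most one literal per variable, so distinct clauses get distinct
-- words; a clause satisfied by v gets a word with an agreeing letter. There are only
-- 3^n - 2^n such words, and f(n) = 3^n - 2^n by the binomial theorem.
module Submission where

open import Defs
open import Data.Nat using (ℕ; zero; suc; _+_; _*_; _∸_; _^_; _≤_; _<_)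
open import Data.Nat.Properties
  using (+-assoc; ^-zeroˡ; *-identityˡ; *-zeroʳ; +-identityʳ; n<1+n; m+n∸n≡m; <⇒≱; module ≤-Reasoning)
open import Data.Nat.Combinatorics using (_C_; nCk+nC[k+1]≡[n+1]C[k+1]; k>n⇒nCk≡0)
open import Data.Nat.Tactic.RingSolver using (solve-∀)
open import Data.Bool as Bool using (not)
open import Data.Bool.Properties using (¬-not)
open import Data.Fin as Fin using (Fin)
open import Data.Fin.Properties using (injective⇒≤)
open import Data.Vec as Vec using (Vec; []; _∷_; tabulate)
open import Data.Vec.Properties using (lookup∘tabulate)
open import Data.List using (List; []; _∷_; length; map; _++_; lookup)
open import Data.List.Properties using (length-++; length-map)
open import Data.List.Relation.Unary.All as All using (All; []; _∷_)
open import Data.List.Relation.Unary.Any using (Any; here; index)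
open import Data.List.Relation.Unary.Any.Properties using (lookup-index)
open import Data.List.Relation.Unary.AllPairs using (AllPairs; []; _∷_)
open import Data.List.Relation.Unary.AllPairs.Properties using (map⁺)
open import Data.List.Relation.Unary.Unique.Propositional using (Unique)
open import Data.List.Membership.Propositional using (_∈_; find)
open import Data.List.Membership.Propositional.Properties
  using (∈-++⁺ˡ; ∈-++⁺ʳ; ∈-map⁺; ∈-map⁻; ∈-lookup)
open import Data.List.Relation.Binary.Subset.Propositional using (_⊆_)
open import Data.Product using (∃; _,_)
open import Data.Product.Properties using (≡-dec)
open import Data.Empty using (⊥-elim)
open import Function.Definitions using (Injective)
open import Relation.Nullary using (¬_; Dec; yes; no)
open import Relation.Binary.PropositionalEquality

binomialSum : ℕ → ℕ → ℕ → ℕ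
binomialSum m k x = sumFrom1 k (λ i → x ^ i * (m C i))

binomialSum-pascal : ∀ m k x →
  binomialSum (suc m) (suc k) x ≡ x * (1 + binomialSum m k x) + binomialSum m (suc k) x
binomialSum-pascal m zero x = begin
  0 + x * 1 * (suc m C 1)              ≡⟨ cong (λ c → 0 + x * 1 * c) (sym (nCk+nC[k+1]≡[n+1]C[k+1] m 0)) ⟩
  0 + x * 1 * (1 + m C 1)              ≡⟨ rearrange x (m C 1) ⟩
  x * (1 + 0) + (0 + x * 1 * (m C 1))  ∎
  where
  open ≡-Reasoning
  rearrange : ∀ x c → 0 + x * 1 * (1 + c) ≡ x * (1 + 0) + (0 + x * 1 * c)
  rearrange = solve-∀
binomialSum-pascal m (suc k) x = begin
  binomialSum (suc m) (suc k) x + x ^ (2 + k) * (suc m C (2 + k))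
    ≡⟨ cong₂ (λ s c → s + x ^ (2 + k) * c) (binomialSum-pascal m k x)
             (sym (nCk+nC[k+1]≡[n+1]C[k+1] m (suc k))) ⟩
  x * (1 + s) + (s + p * c₁) + x * p * (c₁ + c₂)
    ≡⟨ rearrange x s p c₁ c₂ ⟩
  x * (1 + (s + p * c₁)) + (s + p * c₁ + x * p * c₂) ∎
  where
  open ≡-Reasoning
  s = binomialSum m k x
  p = x ^ suc k
  c₁ = m C suc k
  c₂ = m C (2 + k)
  rearrange : ∀ x s p c₁ c₂ →
    x * (1 + s) + (s + p * c₁) + x * p * (c₁ + c₂) ≡ x * (1 + (s + p * c₁)) + (s + p * c₁ + x * p * c₂)
  rearrange = solve-∀

binomialSum-beyond : ∀ m x → binomialSum m (suc m) x ≡ binomialSum m m x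
binomialSum-beyond m x = begin
  binomialSum m m x + x ^ suc m * (m C suc m)  ≡⟨ cong (λ c → binomialSum m m x + x ^ suc m * c) (k>n⇒nCk≡0 (n<1+n m)) ⟩
  binomialSum m m x + x ^ suc m * 0            ≡⟨ cong (binomialSum m m x +_) (*-zeroʳ (x ^ suc m)) ⟩
  binomialSum m m x + 0                        ≡⟨ +-identityʳ _ ⟩
  binomialSum m m x                            ∎
  where open ≡-Reasoning

binomial-theorem : ∀ m x → 1 + binomialSum m m x ≡ (1 + x) ^ m
binomial-theorem zero x = refl
binomial-theorem (suc m) x = begin
  1 + binomialSum (suc m) (suc m) x            ≡⟨ cong (1 +_) (binomialSum-pascal m m x) ⟩
  1 + (x * (1 + s) + binomialSum m (suc m) x)  ≡⟨ cong (λ t → 1 + (x * (1 + s) + t)) (binomialSum-beyond m x) ⟩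
  1 + (x * (1 + s) + s)                        ≡⟨ rearrange x s ⟩
  (1 + x) * (1 + s)                            ≡⟨ cong ((1 + x) *_) (binomial-theorem m x) ⟩
  (1 + x) * (1 + x) ^ m                        ∎
  where
  open ≡-Reasoning
  s = binomialSum m m x
  rearrange : ∀ x s → 1 + (x * (1 + s) + s) ≡ (1 + x) * (1 + s)
  rearrange = solve-∀

sumFrom1-cong : ∀ k {g h : ℕ → ℕ} → (∀ i → g i ≡ h i) → sumFrom1 k g ≡ sumFrom1 k h
sumFrom1-cong zero    g≗h = refl
sumFrom1-cong (suc k) g≗h = cong₂ _+_ (sumFrom1-cong k g≗h) (g≗h (suc k))

f≡3^n∸2^n : ∀ n → f n ≡ 3 ^ n ∸ 2 ^ n
f≡3^n∸2^n n = cong₂ _∸_ (binomial-theorem n 2) (begin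
  1 + sumFrom1 n (n C_)  ≡⟨ cong (1 +_) (sumFrom1-cong n (λ i → sym (1^i*c≡c i (n C i)))) ⟩
  1 + binomialSum n n 1  ≡⟨ binomial-theorem n 1 ⟩
  2 ^ n                  ∎)
  where
  open ≡-Reasoning
  1^i*c≡c : ∀ i c → 1 ^ i * c ≡ c
  1^i*c≡c i c = trans (cong (_* c) (^-zeroˡ i)) (*-identityˡ c)

data Occurrence : Set where
  absent agreeing opposing : Occurrence

prepend : ∀ {n} → Occurrence → List (Vec Occurrence n) → List (Vec Occurrence (suc n))
prepend o = map (o ∷_)

allVectors : ∀ n → List (Vec Occurrence n)
allVectors zero    = [] ∷ []
allVectors (suc n) = prepend absent (allVectors n) ++ prepend agreeing (allVectors n)
                       ++ prepend opposing (allVectors n)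

vectorsWithAgreeing : ∀ n → List (Vec Occurrence n)
vectorsWithAgreeing zero    = []
vectorsWithAgreeing (suc n) = prepend agreeing (allVectors n) ++ prepend absent (vectorsWithAgreeing n)
                                ++ prepend opposing (vectorsWithAgreeing n)

length-prepend³ : ∀ {n} a b c (xs ys zs : List (Vec Occurrence n)) →
  length (prepend a xs ++ prepend b ys ++ prepend c zs) ≡ length xs + length ys + length zs
length-prepend³ a b c xs ys zs = begin
  length (prepend a xs ++ prepend b ys ++ prepend c zs)
    ≡⟨ length-++ (prepend a xs) ⟩
  length (prepend a xs) + length (prepend b ys ++ prepend c zs)
    ≡⟨ cong (length (prepend a xs) +_) (length-++ (prepend b ys)) ⟩
  length (prepend a xs) + (length (prepend b ys) + length (prepend c zs))
    ≡⟨ cong₂ _+_ (length-map (a ∷_) xs) (cong₂ _+_ (length-map (b ∷_) ys) (length-map (c ∷_) zs)) ⟩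
  length xs + (length ys + length zs)
    ≡⟨ sym (+-assoc (length xs) (length ys) (length zs)) ⟩
  length xs + length ys + length zs ∎
  where open ≡-Reasoning

length-allVectors : ∀ n → length (allVectors n) ≡ 3 ^ n
length-allVectors zero    = refl
length-allVectors (suc n) = begin
  length (allVectors (suc n))  ≡⟨ length-prepend³ absent agreeing opposing (allVectors n) (allVectors n) (allVectors n) ⟩
  a + a + a                    ≡⟨ cong (λ t → t + t + t) (length-allVectors n) ⟩
  t + t + t                    ≡⟨ rearrange t ⟩
  3 * t                        ∎
  where
  open ≡-Reasoning
  a = length (allVectors n)
  t = 3 ^ n
  rearrange : ∀ t → t + t + t ≡ 3 * t
  rearrange = solve-∀

length-vectorsWithAgreeing+2^n : ∀ n → length (vectorsWithAgreeing n) + 2 ^ n ≡ 3 ^ n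
length-vectorsWithAgreeing+2^n zero    = refl
length-vectorsWithAgreeing+2^n (suc n) = begin
  length (vectorsWithAgreeing (suc n)) + 2 * t
    ≡⟨ cong (_+ 2 * t) (length-prepend³ agreeing absent opposing (allVectors n) (vectorsWithAgreeing n) (vectorsWithAgreeing n)) ⟩
  length (allVectors n) + w + w + 2 * t
    ≡⟨ cong (λ a → a + w + w + 2 * t) (length-allVectors n) ⟩
  3 ^ n + w + w + 2 * t
    ≡⟨ cong (λ a → a + w + w + 2 * t) (sym (length-vectorsWithAgreeing+2^n n)) ⟩
  (w + t) + w + w + 2 * t
    ≡⟨ rearrange w t ⟩
  3 * (w + t)
    ≡⟨ cong (3 *_) (length-vectorsWithAgreeing+2^n n) ⟩
  3 * 3 ^ n ∎
  where
  open ≡-Reasoning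
  w = length (vectorsWithAgreeing n)
  t = 2 ^ n
  rearrange : ∀ w t → (w + t) + w + w + 2 * t ≡ 3 * (w + t)
  rearrange = solve-∀

length-vectorsWithAgreeing : ∀ n → length (vectorsWithAgreeing n) ≡ 3 ^ n ∸ 2 ^ n
length-vectorsWithAgreeing n = begin
  length (vectorsWithAgreeing n)                  ≡⟨ sym (m+n∸n≡m _ (2 ^ n)) ⟩
  length (vectorsWithAgreeing n) + 2 ^ n ∸ 2 ^ n  ≡⟨ cong (_∸ 2 ^ n) (length-vectorsWithAgreeing+2^n n) ⟩
  3 ^ n ∸ 2 ^ n                                   ∎
  where open ≡-Reasoning

∈-allVectors : ∀ {n} (w : Vec Occurrence n) → w ∈ allVectors n
∈-allVectors []                     = here refl
∈-allVectors {suc n} (absent ∷ w)   = ∈-++⁺ˡ (∈-map⁺ _ (∈-allVectors w))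
∈-allVectors {suc n} (agreeing ∷ w) =
  ∈-++⁺ʳ (prepend absent (allVectors n)) (∈-++⁺ˡ (∈-map⁺ _ (∈-allVectors w)))
∈-allVectors {suc n} (opposing ∷ w) =
  ∈-++⁺ʳ (prepend absent (allVectors n)) (∈-++⁺ʳ (prepend agreeing (allVectors n)) (∈-map⁺ _ (∈-allVectors w)))

∈-vectorsWithAgreeing : ∀ {n} (w : Vec Occurrence n) (x : Fin n) →
  Vec.lookup w x ≡ agreeing → w ∈ vectorsWithAgreeing n
∈-vectorsWithAgreeing (agreeing ∷ w) _ _ = ∈-++⁺ˡ (∈-map⁺ _ (∈-allVectors w))
∈-vectorsWithAgreeing (absent ∷ w)   Fin.zero ()
∈-vectorsWithAgreeing (opposing ∷ w) Fin.zero ()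
∈-vectorsWithAgreeing {suc n} (absent ∷ w) (Fin.suc x) wₓ≡agreeing =
  ∈-++⁺ʳ (prepend agreeing (allVectors n)) (∈-++⁺ˡ (∈-map⁺ _ (∈-vectorsWithAgreeing w x wₓ≡agreeing)))
∈-vectorsWithAgreeing {suc n} (opposing ∷ w) (Fin.suc x) wₓ≡agreeing =
  ∈-++⁺ʳ (prepend agreeing (allVectors n))
    (∈-++⁺ʳ (prepend absent (vectorsWithAgreeing n)) (∈-map⁺ _ (∈-vectorsWithAgreeing w x wₓ≡agreeing)))

classify : ∀ {p q} {P : Set p} {Q : Set q} → Dec P → Dec Q → Occurrence
classify (yes _) _       = agreeing
classify (no _)  (yes _) = opposing
classify (no _)  (no _)  = absent

module _ {p q} {P : Set p} {Q : Set q} where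

  classify-agreeing⁻ : (P? : Dec P) (Q? : Dec Q) → classify P? Q? ≡ agreeing → P
  classify-agreeing⁻ (yes p) _       _  = p
  classify-agreeing⁻ (no _)  (yes _) ()
  classify-agreeing⁻ (no _)  (no _)  ()

  classify-agreeing⁺ : (P? : Dec P) (Q? : Dec Q) → P → classify P? Q? ≡ agreeing
  classify-agreeing⁺ (yes _) _ _ = refl
  classify-agreeing⁺ (no ¬p) _ p = ⊥-elim (¬p p)

  classify-opposing⁻ : (P? : Dec P) (Q? : Dec Q) → classify P? Q? ≡ opposing → Q
  classify-opposing⁻ (yes _) _       ()
  classify-opposing⁻ (no _)  (yes q) _  = q
  classify-opposing⁻ (no _)  (no _)  ()

  classify-opposing⁺ : (P? : Dec P) (Q? : Dec Q) → ¬ P → Q → classify P? Q? ≡ opposing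
  classify-opposing⁺ (yes p) _       ¬p _ = ⊥-elim (¬p p)
  classify-opposing⁺ (no _)  (yes _) _  _ = refl
  classify-opposing⁺ (no _)  (no ¬q) _  q = ⊥-elim (¬q q)

module _ {n : ℕ} (v : Assignment n) where
  open import Data.List.Membership.DecPropositional (≡-dec (Fin._≟_ {n}) Bool._≟_) using (_∈?_)

  occurrence : Clause n → Fin n → Occurrence
  occurrence c x = classify ((x , v x) ∈? c) ((x , not (v x)) ∈? c)

  code : Clause n → Vec Occurrence n
  code c = tabulate (occurrence c)

  ⊆-of-same-occurrences : ∀ {c d} → PreciseClause c →
    (∀ x → occurrence c x ≡ occurrence d x) → ∀ l → l ∈ c → l ∈ d
  ⊆-of-same-occurrences {c} {d} (_ , _ , consistent) same (x , b) l∈c with b Bool.≟ v x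
  ... | yes refl = classify-agreeing⁻ _ _ (trans (sym (same x)) (classify-agreeing⁺ _ _ l∈c))
  ... | no b≢vₓ rewrite ¬-not b≢vₓ =
    classify-opposing⁻ _ _ (trans (sym (same x)) (classify-opposing⁺ _ _ (λ vₓ∈c → consistent _ vₓ∈c l∈c) l∈c))

  code-injective : ∀ {c d} → PreciseClause c → PreciseClause d → code c ≡ code d → SameSet c d
  code-injective {c} {d} precise-c precise-d codes≡ =
    ⊆-of-same-occurrences precise-c same , ⊆-of-same-occurrences precise-d (λ x → sym (same x))
    where
    same : ∀ x → occurrence c x ≡ occurrence d x
    same x = begin
      occurrence c x           ≡⟨ lookup∘tabulate (occurrence c) x ⟨
      Vec.lookup (code c) x    ≡⟨ cong (λ w → Vec.lookup w x) codes≡ ⟩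
      Vec.lookup (code d) x    ≡⟨ lookup∘tabulate (occurrence d) x ⟩
      occurrence d x           ∎
      where open ≡-Reasoning

  code-satisfied : ∀ {c} → Any (litTrue v) c → code c ∈ vectorsWithAgreeing n
  code-satisfied {c} satisfied with find satisfied
  ... | (x , _) , l∈c , refl = ∈-vectorsWithAgreeing (code c) x
    (trans (lookup∘tabulate (occurrence c) x) (classify-agreeing⁺ _ _ l∈c))

lookup-injective : ∀ {A : Set} {xs : List A} → Unique xs → Injective _≡_ _≡_ (lookup xs)
lookup-injective {xs = _ ∷ _}  (_    ∷ _)      {Fin.zero}  {Fin.zero}  _   = refl
lookup-injective {xs = _ ∷ xs} (x∉xs ∷ _)      {Fin.zero}  {Fin.suc j} eq  = ⊥-elim (All.lookup x∉xs (∈-lookup j) eq)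
lookup-injective {xs = _ ∷ xs} (x∉xs ∷ _)      {Fin.suc i} {Fin.zero}  eq  = ⊥-elim (All.lookup x∉xs (∈-lookup i) (sym eq))
lookup-injective {xs = _ ∷ _}  (_    ∷ unique) {Fin.suc i} {Fin.suc j} eq  = cong Fin.suc (lookup-injective unique eq)

Unique⇒length≤ : ∀ {A : Set} {xs ys : List A} → Unique xs → xs ⊆ ys → length xs ≤ length ys
Unique⇒length≤ {xs = xs} {ys} unique xs⊆ys = injective⇒≤ {f = position} position-injective
  where
  position : Fin (length xs) → Fin (length ys)
  position i = index (xs⊆ys (∈-lookup i))
  position-injective : Injective _≡_ _≡_ position
  position-injective {i} {j} eq = lookup-injective unique (begin
    lookup xs i             ≡⟨ lookup-index (xs⊆ys (∈-lookup i)) ⟩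
    lookup ys (position i)  ≡⟨ cong (lookup ys) eq ⟩
    lookup ys (position j)  ≡⟨ lookup-index (xs⊆ys (∈-lookup j)) ⟨
    lookup xs j             ∎)
    where open ≡-Reasoning

AllPairs-within : ∀ {A : Set} {P : A → Set} {R S : A → A → Set} →
  (∀ {x y} → P x → P y → R x y → S x y) → ∀ {xs} → All P xs → AllPairs R xs → AllPairs S xs
AllPairs-within r []         []         = []
AllPairs-within r (px ∷ pxs) (rx ∷ rxs) =
  All.zipWith (λ (py , rxy) → r px py rxy) (pxs , rx) ∷ AllPairs-within r pxs rxs

theorem2 : (n : ℕ) → 1 ≤ n → (φ : Formula n) → IsPCNF φ →
    f n < length φ → ¬ ∃ (λ (v : Assignment n) → Satisfies v φ)
theorem2 n _ φ (precise , distinct) f<|φ| (v , satisfied) = <⇒≱ f<|φ| (begin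
  length φ                        ≡⟨ length-map (code v) φ ⟨
  length (map (code v) φ)         ≤⟨ Unique⇒length≤ codes-unique codes-agreeing ⟩
  length (vectorsWithAgreeing n)  ≡⟨ length-vectorsWithAgreeing n ⟩
  3 ^ n ∸ 2 ^ n                   ≡⟨ f≡3^n∸2^n n ⟨
  f n                             ∎)
  where
  open ≤-Reasoning
  codes-unique : Unique (map (code v) φ)
  codes-unique = map⁺ (AllPairs-within (λ pc pd ¬same codes≡ → ¬same (code-injective v pc pd codes≡))
                                        precise distinct)
  codes-agreeing : map (code v) φ ⊆ vectorsWithAgreeing n
  codes-agreeing w∈ with ∈-map⁻ (code v) w∈
  ... | c , c∈φ , refl = code-satisfied v (All.lookup satisfied c∈φ)
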